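{- Let $Z=(U,\Omega,r)$ be a multimatroid with a singular element $e$, and let $\omega$ be the skew class containing $e$. Then $\mathcal C(Z) = \mathcal C(Z\setminus \omega) \cup \{\{e\}\}$.
   Context: A carrier is a pair $(U,\Omega)$, $U$ finite, $\Omega$ a partition of $U$ into non-empty skew classes; subtransversals meet each skew class at most once, transversals exactly once; skew pair: two distinct elements of a skew class. A multimatroid $Z=(U,\Omega,r)$ has a non-negative integer $r$ on subtransversals with (R1) on each transversal $r$ is a matroid rank function; (R2) for subtransversal $S$ and skew pair $\{x,y\}$ in a skew class disjoint from $S$, $r(S\cup\{x\})+r(S\cup\{y\})-2r(S)\ge1$. A circuit is a minimal subtransversal $S$ with $r(S)<|S|$; $\mathcal C(Z)$ is the set of circuits. An element $e$ is singular if $r(\{e\})=0$. The restriction $Z\setminus\omega$ is the multimatroid $(U-\omega,\Omega-\{\omega\},r')$ where $r'$ is the restriction of $r$ to subtransversals of $\Omega-\{\omega\}$. -}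

module Defs where

open import Data.Nat using (ℕ; _≤_; _<_; _+_; _*_; suc)
open import Data.Nat.Properties using (_≟_)
open import Data.Bool using (_∧_; not)
open import Data.Fin using (Fin)
open import Data.Fin.Subset using (Subset; _─_; _∈_; _∉_; _⊆_; _⊂_; _∪_; _∩_; ∣_∣; ⁅_⁆)
open import Data.Vec using (tabulate; lookup)
open import Data.Product using (∃; _×_; _,_)
open import Relation.Nullary using (¬_; does)
open import Relation.Binary.PropositionalEquality using (_≡_; _≢_)

-- Elements live in the ambient universe Fin n; the
-- ground set U is a subset of Fin n, and the partition Ω of U is given by a
-- labelling `cls`: two elements of U lie in the same skew class iff they have
-- the same label.
record Carrier (n : ℕ) : Set where
  constructor carrier
  field
    U   : Subset n
    cls : Fin n → ℕ
open Carrier public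

module _ {n : ℕ} (C : Carrier n) where

  SameClass : Fin n → Fin n → Set
  SameClass x y = x ∈ U C × y ∈ U C × cls C x ≡ cls C y

  skewClassOf : Fin n → Subset n
  skewClassOf e = tabulate λ x → lookup (U C) x ∧ does (cls C x ≟ cls C e)

  IsSubtransversal : Subset n → Set
  IsSubtransversal S = S ⊆ U C × (∀ x y → x ∈ S → y ∈ S → cls C x ≡ cls C y → x ≡ y)

  IsTransversal : Subset n → Set
  IsTransversal T = IsSubtransversal T × (∀ x → x ∈ U C → ∃ λ y → y ∈ T × cls C y ≡ cls C x)

IsMatroidRankOn : {n : ℕ} → (Subset n → ℕ) → Subset n → Set
IsMatroidRankOn r T =
  (∀ A → A ⊆ T → r A ≤ ∣ A ∣) ×
  (∀ A B → A ⊆ T → B ⊆ T → A ⊆ B → r A ≤ r B) ×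
  (∀ A B → A ⊆ T → B ⊆ T → r (A ∪ B) + r (A ∩ B) ≤ r A + r B)

-- (U, Ω, r) is a multimatroid.  The rank function is given on all subsets of
-- the universe, but only its values on subtransversals are constrained / used.
record IsMultimatroid {n : ℕ} (C : Carrier n) (r : Subset n → ℕ) : Set where
  field
    R1 : ∀ T → IsTransversal C T → IsMatroidRankOn r T
    R2 : ∀ S x y → IsSubtransversal C S →
         x ∈ U C → y ∈ U C → x ≢ y → cls C x ≡ cls C y →
         (∀ z → z ∈ S → cls C z ≢ cls C x) →
         1 + 2 * r S ≤ r (S ∪ ⁅ x ⁆) + r (S ∪ ⁅ y ⁆)

IsCircuit : {n : ℕ} → Carrier n → (Subset n → ℕ) → Subset n → Set
IsCircuit C r S =
  IsSubtransversal C S × r S < ∣ S ∣ ×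
  (∀ T → IsSubtransversal C T → T ⊂ S → ¬ (r T < ∣ T ∣))

IsSingular : {n : ℕ} → Carrier n → (Subset n → ℕ) → Fin n → Set
IsSingular C r e = e ∈ U C × r ⁅ e ⁆ ≡ 0

-- Carrier of the restriction Z \ ω, where ω is the skew class of e:
-- ground set U - ω, same partition labels (so Ω - {ω}); the rank function of
-- Z \ ω is r itself, restricted to subtransversals of the new carrier.
deleteClassOf : {n : ℕ} → Carrier n → Fin n → Carrier n
deleteClassOf C e =
  carrier (U C ─ skewClassOf C e) (cls C)

{-# OPTIONS --safe #-}
-- {e} is a circuit because r{e} = 0, and a circuit containing e is {e} by
-- minimality.  A circuit S cannot meet ω in some x ≠ e: S' = S - x avoids ω,
-- and submodularity inside a transversal extending S' ∪ {e} gives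
-- r(S' ∪ {e}) ≤ r(S') + r{e} = r(S'), so (R2) for the skew pair {x, e} forces
-- r(S) ≥ r(S') + 1 ≥ |S'| + 1 = |S|, as S' is independent by minimality.
-- The remaining circuits avoid ω, and those are exactly the circuits of Z \ ω.
module Submission where

open import Defs
open import Data.Nat using (ℕ; suc; _≤_; _<_; _+_; _*_; _<?_; s≤s; z<s)
open import Data.Nat.Induction using (<-wellFounded)
open import Data.Nat.Properties
  using (_≟_; suc-injective; ≤-trans; ≤-antisym; ≮⇒≥; ≤⇒≯; n≮0; ≤-pred; <-≤-trans; m≤m+n; +-identityʳ; +-monoʳ-≤; +-cancelʳ-≤; module ≤-Reasoning)
open import Data.Bool using (Bool; true)
open import Data.Fin using (Fin; toℕ)
import Data.Fin as Fin
open import Data.Fin.Properties using (toℕ-injective; all?; ¬∀⟶∃¬)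
open import Data.Fin.Subset using (Subset; ⁅_⁆; _∈_; _⊆_; _⊂_; _∪_; _-_; ∣_∣; ⊥; inside; outside)
open import Data.Fin.Subset.Properties
  using (_∈?_; x∈⁅y⁆⇒x≡y; ∣⁅x⁆∣≡1; ⊆-antisym; ⊆-trans; p⊆p∪q; q⊆p∪q; x∈p∪q⁻; p─⊥≡p; ∪-identityʳ; p─q⊆p; x∈p∧x∉q⇒x∈p─q; x∈p⇒p-x⊂p; p⊂q⇒∣p∣<∣q∣)
open import Data.Vec using (_∷_; tabulate; lookup; here; there)
open import Data.Vec.Properties using (lookup∘tabulate; []=⇒lookup; lookup⇒[]=)
open import Data.Product using (∃; _×_; _,_; proj₁; proj₂)
open import Data.Sum using (_⊎_; inj₁; inj₂)
open import Function using (_∘_)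
open import Function.Bundles using (_⇔_; mk⇔; Equivalence)
open import Induction.WellFounded using (Acc; acc)
open import Relation.Nullary using (¬_; Dec; yes; no; does; proof; contradiction)
open import Relation.Nullary.Reflects using (Reflects; invert)
open import Relation.Nullary.Decidable using (_×-dec_; ¬?; dec-true; decidable-stable)
open import Relation.Binary.PropositionalEquality using (_≡_; _≢_; refl; sym; trans; cong; subst; subst₂)

does≡true⇒ : {P : Set} (P? : Dec P) → does P? ≡ true → P
does≡true⇒ {P} P? eq = invert (subst (Reflects P) eq (proof P?))

∈tabulate⇔ : ∀ {n} {f : Fin n → Bool} {x : Fin n} → x ∈ tabulate f ⇔ f x ≡ true
∈tabulate⇔ {f = f} {x} = mk⇔
  (λ x∈ → trans (sym (lookup∘tabulate f x)) ([]=⇒lookup x∈))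
  (λ fx → lookup⇒[]= x (tabulate f) (trans (lookup∘tabulate f x) fx))

x∈p-y⇒x≢y : ∀ {n} (p : Subset n) {x y : Fin n} → x ∈ p - y → x ≢ y
x∈p-y⇒x≢y (inside ∷ p) {Fin.zero} () refl
x∈p-y⇒x≢y (_ ∷ p) {Fin.suc x} (there x∈) refl = x∈p-y⇒x≢y p x∈ refl

∣p∣≡1+∣p-x∣ : ∀ {n} (p : Subset n) {x : Fin n} → x ∈ p → ∣ p ∣ ≡ suc ∣ p - x ∣
∣p∣≡1+∣p-x∣ (inside ∷ p) here = cong (suc ∘ ∣_∣) (sym (p─⊥≡p p))
∣p∣≡1+∣p-x∣ (inside ∷ p) (there x∈p) = cong suc (∣p∣≡1+∣p-x∣ p x∈p)
∣p∣≡1+∣p-x∣ (outside ∷ p) (there x∈p) = ∣p∣≡1+∣p-x∣ p x∈p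

p-x∪⁅x⁆≡p : ∀ {n} (p : Subset n) {x : Fin n} → x ∈ p → (p - x) ∪ ⁅ x ⁆ ≡ p
p-x∪⁅x⁆≡p (inside ∷ p) here = cong (inside ∷_) (trans (cong (_∪ ⊥) (p─⊥≡p p)) (∪-identityʳ p))
p-x∪⁅x⁆≡p (inside ∷ p) (there x∈p) = cong (inside ∷_) (p-x∪⁅x⁆≡p p x∈p)
p-x∪⁅x⁆≡p (outside ∷ p) (there x∈p) = cong (outside ∷_) (p-x∪⁅x⁆≡p p x∈p)

module _ {n : ℕ} (C : Carrier n) where

  ∈skewClassOf⇒≡cls : ∀ {e x} → x ∈ skewClassOf C e → cls C x ≡ cls C e
  ∈skewClassOf⇒≡cls {e} {x} x∈ω with lookup (U C) x | Equivalence.to ∈tabulate⇔ x∈ω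
  ... | true | eq = does≡true⇒ (cls C x ≟ cls C e) eq

  ⊆-subtransversal : ∀ {S T} → T ⊆ S → IsSubtransversal C S → IsSubtransversal C T
  ⊆-subtransversal T⊆S (S⊆U , unique) =
    ⊆-trans T⊆S S⊆U , λ x y x∈T y∈T → unique x y (T⊆S x∈T) (T⊆S y∈T)

  ⁅⁆-subtransversal : ∀ {x} → x ∈ U C → IsSubtransversal C ⁅ x ⁆
  ⁅⁆-subtransversal {x} x∈U =
    (λ y∈ → subst (_∈ U C) (sym (x∈⁅y⁆⇒x≡y x y∈)) x∈U) ,
    λ y z y∈ z∈ _ → trans (x∈⁅y⁆⇒x≡y x y∈) (sym (x∈⁅y⁆⇒x≡y x z∈))

  ∪⁅⁆-subtransversal : ∀ {S y} → IsSubtransversal C S → y ∈ U C →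
    (∀ z → z ∈ S → cls C z ≢ cls C y) → IsSubtransversal C (S ∪ ⁅ y ⁆)
  ∪⁅⁆-subtransversal {S} {y} (S⊆U , unique) y∈U avoids = S∪y⊆U , unique′
    where
    S∪y⊆U : S ∪ ⁅ y ⁆ ⊆ U C
    S∪y⊆U z∈ with x∈p∪q⁻ S ⁅ y ⁆ z∈
    ... | inj₁ z∈S = S⊆U z∈S
    ... | inj₂ z∈y = proj₁ (⁅⁆-subtransversal y∈U) z∈y

    unique′ : ∀ a b → a ∈ S ∪ ⁅ y ⁆ → b ∈ S ∪ ⁅ y ⁆ → cls C a ≡ cls C b → a ≡ b
    unique′ a b a∈ b∈ a~b with x∈p∪q⁻ S ⁅ y ⁆ a∈ | x∈p∪q⁻ S ⁅ y ⁆ b∈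
    ... | inj₁ a∈S | inj₁ b∈S = unique a b a∈S b∈S a~b
    ... | inj₂ a∈y | inj₂ b∈y = trans (x∈⁅y⁆⇒x≡y y a∈y) (sym (x∈⁅y⁆⇒x≡y y b∈y))
    ... | inj₁ a∈S | inj₂ b∈y = contradiction (trans a~b (cong (cls C) (x∈⁅y⁆⇒x≡y y b∈y))) (avoids a a∈S)
    ... | inj₂ a∈y | inj₁ b∈S = contradiction (trans (sym a~b) (cong (cls C) (x∈⁅y⁆⇒x≡y y a∈y))) (avoids b b∈S)

  module ClassMinima (key : Fin n → ℕ) where

    Undercuts : Fin n → Fin n → Set
    Undercuts z x = z ∈ U C × cls C z ≡ cls C x × key z < key x

    IsClassMinimum : Fin n → Set
    IsClassMinimum x = x ∈ U C × (∀ z → ¬ Undercuts z x)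

    undercuts? : ∀ z x → Dec (Undercuts z x)
    undercuts? z x = z ∈? U C ×-dec cls C z ≟ cls C x ×-dec key z <? key x

    isClassMinimum? : ∀ x → Dec (IsClassMinimum x)
    isClassMinimum? x = x ∈? U C ×-dec all? (λ z → ¬? (undercuts? z x))

    classMinima : Subset n
    classMinima = tabulate (does ∘ isClassMinimum?)

    ∈classMinima⇔ : ∀ {x} → x ∈ classMinima ⇔ IsClassMinimum x
    ∈classMinima⇔ {x} = mk⇔
      (does≡true⇒ (isClassMinimum? x) ∘ Equivalence.to ∈tabulate⇔)
      (Equivalence.from ∈tabulate⇔ ∘ dec-true (isClassMinimum? x))

    classMinimum-exists : ∀ x → Acc _<_ (key x) → x ∈ U C → ∃ λ y → IsClassMinimum y × cls C y ≡ cls C x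
    classMinimum-exists x (acc below) x∈U with isClassMinimum? x
    ... | yes x-min = x , x-min , refl
    ... | no ¬x-min =
      let z , ¬¬undercut = ¬∀⟶∃¬ n _ (λ z → ¬? (undercuts? z x)) (λ none → ¬x-min (x∈U , none))
          z∈U , z~x , z<x = decidable-stable (undercuts? z x) ¬¬undercut
          y , y-min , y~z = classMinimum-exists z (below z<x) z∈U
      in y , y-min , trans y~z z~x

    classMinima-isTransversal : (∀ x y → cls C x ≡ cls C y → key x ≡ key y → x ≡ y) →
      IsTransversal C classMinima
    classMinima-isTransversal key-injective =
      (proj₁ ∘ minimal , unique) , λ x x∈U →
        let y , y-min , y~x = classMinimum-exists x (<-wellFounded (key x)) x∈U
        in y , Equivalence.from ∈classMinima⇔ y-min , y~x
      where
      minimal : ∀ {x} → x ∈ classMinima → IsClassMinimum x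
      minimal = Equivalence.to ∈classMinima⇔

      unique : ∀ x y → x ∈ classMinima → y ∈ classMinima → cls C x ≡ cls C y → x ≡ y
      unique x y x∈ y∈ x~y = key-injective x y x~y (≤-antisym
        (≮⇒≥ λ y<x → proj₂ (minimal x∈) y (proj₁ (minimal y∈) , sym x~y , y<x))
        (≮⇒≥ λ x<y → proj₂ (minimal y∈) x (proj₁ (minimal x∈) , x~y , x<y)))

  -- Witness: the class-wise minima of a key that puts A first (key 0) and is
  -- otherwise injective.
  subtransversal⇒⊆transversal : ∀ {A} → IsSubtransversal C A →
    ∃ λ T → IsTransversal C T × A ⊆ T
  subtransversal⇒⊆transversal {A} (A⊆U , A-unique) =
    classMinima , classMinima-isTransversal key-injective ,
    λ x∈A → Equivalence.from ∈classMinima⇔ (A-minimal x∈A)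
    where
    key : Fin n → ℕ
    key x with x ∈? A
    ... | yes _ = 0
    ... | no _ = suc (toℕ x)

    open ClassMinima key

    key-injective : ∀ x y → cls C x ≡ cls C y → key x ≡ key y → x ≡ y
    key-injective x y x~y kx≡ky with x ∈? A | y ∈? A
    ... | yes x∈A | yes y∈A = A-unique x y x∈A y∈A x~y
    ... | no _ | no _ = toℕ-injective (suc-injective kx≡ky)

    key≡0 : ∀ {x} → x ∈ A → key x ≡ 0
    key≡0 {x} x∈A with x ∈? A
    ... | yes _ = refl
    ... | no x∉A = contradiction x∈A x∉A

    A-minimal : ∀ {x} → x ∈ A → IsClassMinimum x
    A-minimal x∈A = A⊆U x∈A , λ _ (_ , _ , z<x) → n≮0 (subst (_ <_) (key≡0 x∈A) z<x)

module _ {n : ℕ} (C : Carrier n) (e : Fin n) where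

  subtransversal-deleteClassOf⁻ : ∀ {S} → IsSubtransversal (deleteClassOf C e) S → IsSubtransversal C S
  subtransversal-deleteClassOf⁻ (S⊆U′ , unique) = ⊆-trans S⊆U′ (p─q⊆p (U C) (skewClassOf C e)) , unique

  subtransversal-deleteClassOf⁺ : ∀ {S} → IsSubtransversal C S →
    (∀ x → x ∈ S → cls C x ≢ cls C e) → IsSubtransversal (deleteClassOf C e) S
  subtransversal-deleteClassOf⁺ (S⊆U , unique) avoids =
    (λ x∈S → x∈p∧x∉q⇒x∈p─q (S⊆U x∈S) (avoids _ x∈S ∘ ∈skewClassOf⇒≡cls C)) , unique

  module _ (r : Subset n → ℕ) where

    circuit-deleteClassOf⁻ : ∀ {S} → IsCircuit (deleteClassOf C e) r S → IsCircuit C r S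
    circuit-deleteClassOf⁻ (S-sub , dependent , minimal) =
      subtransversal-deleteClassOf⁻ S-sub , dependent ,
      λ T _ T⊂S → minimal T (⊆-subtransversal (deleteClassOf C e) (proj₁ T⊂S) S-sub) T⊂S

    circuit-deleteClassOf⁺ : ∀ {S} → IsCircuit C r S →
      (∀ x → x ∈ S → cls C x ≢ cls C e) → IsCircuit (deleteClassOf C e) r S
    circuit-deleteClassOf⁺ (S-sub , dependent , minimal) avoids =
      subtransversal-deleteClassOf⁺ S-sub avoids , dependent ,
      λ T T-sub → minimal T (subtransversal-deleteClassOf⁻ T-sub)

module _ {n : ℕ} {C : Carrier n} {r : Subset n → ℕ} where

  circuit-minimal : ∀ {S T} → IsCircuit C r S → IsSubtransversal C T → r T < ∣ T ∣ → T ⊆ S → T ≡ S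
  circuit-minimal {S} {T} (_ , _ , minimal) T-sub T-dependent T⊆S = ⊆-antisym T⊆S S⊆T
    where
    S⊆T : S ⊆ T
    S⊆T {x} x∈S with x ∈? T
    ... | yes x∈T = x∈T
    ... | no x∉T = contradiction T-dependent (minimal T T-sub (T⊆S , x , x∈S , x∉T))

  singular⇒⁅⁆-circuit : ∀ {e} → IsSingular C r e → IsCircuit C r ⁅ e ⁆
  singular⇒⁅⁆-circuit {e} (e∈U , re≡0) =
    ⁅⁆-subtransversal C e∈U , r⁅e⁆<1 ,
    λ T _ T⊂⁅e⁆ rT<∣T∣ → n≮0 (<-≤-trans rT<∣T∣ (∣T∣≤0 T⊂⁅e⁆))
    where
    ∣T∣≤0 : ∀ {T} → T ⊂ ⁅ e ⁆ → ∣ T ∣ ≤ 0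
    ∣T∣≤0 {T} T⊂⁅e⁆ = ≤-pred (subst (∣ T ∣ <_) (∣⁅x⁆∣≡1 e) (p⊂q⇒∣p∣<∣q∣ T⊂⁅e⁆))

    r⁅e⁆<1 : r ⁅ e ⁆ < ∣ ⁅ e ⁆ ∣
    r⁅e⁆<1 = subst₂ _<_ (sym re≡0) (sym (∣⁅x⁆∣≡1 e)) z<s

  circuit∋singular⇒≡⁅⁆ : ∀ {e S} → IsSingular C r e → IsCircuit C r S → e ∈ S → S ≡ ⁅ e ⁆
  circuit∋singular⇒≡⁅⁆ {e} {S} e-singular S-circuit e∈S =
    let ⁅e⁆-sub , ⁅e⁆-dependent , _ = singular⇒⁅⁆-circuit e-singular
    in sym (circuit-minimal S-circuit ⁅e⁆-sub ⁅e⁆-dependent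
              (λ y∈ → subst (_∈ S) (sym (x∈⁅y⁆⇒x≡y e y∈)) e∈S))

module _ {n : ℕ} {C : Carrier n} {r : Subset n → ℕ} (Z : IsMultimatroid C r) where
  open IsMultimatroid Z

  rank-subadditive : ∀ A B → IsSubtransversal C (A ∪ B) → r (A ∪ B) ≤ r A + r B
  rank-subadditive A B A∪B-sub =
    let T , T-transversal , A∪B⊆T = subtransversal⇒⊆transversal C A∪B-sub
        _ , _ , submodular = R1 T T-transversal
    in ≤-trans (m≤m+n _ _)
         (submodular A B (⊆-trans (p⊆p∪q {p = A} B) A∪B⊆T) (⊆-trans (q⊆p∪q A B) A∪B⊆T))

  singular-partner-raises-rank : ∀ {e x S} → IsSingular C r e → IsSubtransversal C S →
    x ∈ U C → x ≢ e → cls C x ≡ cls C e → (∀ z → z ∈ S → cls C z ≢ cls C x) →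
    suc (r S) ≤ r (S ∪ ⁅ x ⁆)
  singular-partner-raises-rank {e} {x} {S} (e∈U , re≡0) S-sub x∈U x≢e x~e avoids =
    +-cancelʳ-≤ (r S) (suc (r S)) (r (S ∪ ⁅ x ⁆)) (begin
      suc (r S) + r S               ≡⟨ cong (suc ∘ (r S +_)) (sym (+-identityʳ (r S))) ⟩
      1 + 2 * r S                   ≤⟨ R2 S x e S-sub x∈U e∈U x≢e x~e avoids ⟩
      r (S ∪ ⁅ x ⁆) + r (S ∪ ⁅ e ⁆)   ≤⟨ +-monoʳ-≤ (r (S ∪ ⁅ x ⁆)) r[S∪e]≤rS ⟩
      r (S ∪ ⁅ x ⁆) + r S           ∎)
    where
    open ≤-Reasoning

    r[S∪e]≤rS : r (S ∪ ⁅ e ⁆) ≤ r S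
    r[S∪e]≤rS = begin
      r (S ∪ ⁅ e ⁆)    ≤⟨ rank-subadditive S ⁅ e ⁆ S∪e-sub ⟩
      r S + r ⁅ e ⁆    ≡⟨ cong (r S +_) re≡0 ⟩
      r S + 0          ≡⟨ +-identityʳ (r S) ⟩
      r S              ∎
      where
      S∪e-sub : IsSubtransversal C (S ∪ ⁅ e ⁆)
      S∪e-sub = ∪⁅⁆-subtransversal C S-sub e∈U λ z z∈S z~e → avoids z z∈S (trans z~e (sym x~e))

  circuit-meets-classOf-singular-only-at-it : ∀ {e S x} → IsSingular C r e → IsCircuit C r S →
    x ∈ S → cls C x ≡ cls C e → x ≡ e
  circuit-meets-classOf-singular-only-at-it {e} {S} {x} e-singular (S-sub , dependent , minimal) x∈S x~e
    with x Fin.≟ e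
  ... | yes x≡e = x≡e
  ... | no x≢e = contradiction dependent (≤⇒≯ ∣S∣≤rS)
    where
    open ≤-Reasoning

    S-x-sub : IsSubtransversal C (S - x)
    S-x-sub = ⊆-subtransversal C (p─q⊆p S ⁅ x ⁆) S-sub

    S-x-avoids : ∀ z → z ∈ S - x → cls C z ≢ cls C x
    S-x-avoids z z∈ z~x = x∈p-y⇒x≢y S z∈ (proj₂ S-sub z x (p─q⊆p S ⁅ x ⁆ z∈) x∈S z~x)

    ∣S∣≤rS : ∣ S ∣ ≤ r S
    ∣S∣≤rS = begin
      ∣ S ∣               ≡⟨ ∣p∣≡1+∣p-x∣ S x∈S ⟩
      suc ∣ S - x ∣       ≤⟨ s≤s (≮⇒≥ (minimal (S - x) S-x-sub (x∈p⇒p-x⊂p x∈S))) ⟩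
      suc (r (S - x))     ≤⟨ singular-partner-raises-rank e-singular S-x-sub (proj₁ S-sub x∈S) x≢e x~e S-x-avoids ⟩
      r ((S - x) ∪ ⁅ x ⁆) ≡⟨ cong r (p-x∪⁅x⁆≡p S x∈S) ⟩
      r S                 ∎

lemma2p7 : {n : ℕ} (C : Carrier n) (r : Subset n → ℕ) → IsMultimatroid C r →
    (e : Fin n) → IsSingular C r e →
    (S : Subset n) →
      IsCircuit C r S ⇔ (IsCircuit (deleteClassOf C e) r S ⊎ S ≡ ⁅ e ⁆)
lemma2p7 C r Z e e-singular S = mk⇔ to from
  where
  to : IsCircuit C r S → IsCircuit (deleteClassOf C e) r S ⊎ S ≡ ⁅ e ⁆
  to S-circuit with e ∈? S
  ... | yes e∈S = inj₂ (circuit∋singular⇒≡⁅⁆ e-singular S-circuit e∈S)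
  ... | no e∉S = inj₁ (circuit-deleteClassOf⁺ C e r S-circuit λ x x∈S x~e →
          e∉S (subst (_∈ S) (circuit-meets-classOf-singular-only-at-it Z e-singular S-circuit x∈S x~e) x∈S))

  from : IsCircuit (deleteClassOf C e) r S ⊎ S ≡ ⁅ e ⁆ → IsCircuit C r S
  from (inj₁ S-circuit′) = circuit-deleteClassOf⁻ C e r S-circuit′
  from (inj₂ S≡⁅e⁆) = subst (IsCircuit C r) (sym S≡⁅e⁆) (singular⇒⁅⁆-circuit e-singular)
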